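{- Let $r \ge 1$, let $A$ be the $2^r \times r$ binary code matrix and $M = AA^T$. For $0 \le k \le r$ let $\mathfrak{m}_k$ be the $2^r \times \binom{r}{k}$ submatrix of $M$ consisting of the columns $M_{*,\ell}$ for which row $\ell$ of $A$ has exactly $k$ entries equal to $1$. Let $i \ge 1$ and $z \ge 1$, and let $m$ be any column of $\mathfrak{m}_{2^i + z}$. Then $m^{[i]}$ is a linear combination over $\mathbb{Z}/2\mathbb{Z}$ of the columns of $\mathfrak{m}_{2^i}^{[i]}$.
   Context: The binary code matrix $A \in \{0,1\}^{2^r \times r}$ is the matrix whose rows are all $2^r$ distinct vectors in $\{0,1\}^r$ (the binary expansions of $0,1,\ldots,2^r-1$), ordered so that rows with fewer nonzero entries come first. For an integer vector or matrix $X$ with nonnegative entries, its $2$-adic expansion is $X = X^{[0]} + 2X^{[1]} + 4 X^{[2]} + \cdots$ with each $X^{[i]}$ having entries in $\{0,1\}$ (the $i$th binary digit, taken entrywise). -}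

module Defs where

open import Data.Bool using (Bool; true; false; if_then_else_)
open import Data.Nat using (ℕ; zero; suc; _+_; _*_; _/_; _%_)
open import Data.Vec using (Vec; []; _∷_)
open import Data.List using (List; []; _∷_; map; _++_; filterᵇ)
open import Data.Nat.ListAction using (sum)
import Data.Nat as N

-- Rows of the binary code matrix A : all vectors in {0,1}^r (Bool-coded).
-- Rows (and columns of M = A Aᵀ) are indexed directly by these vectors.
allVecs : (r : ℕ) → List (Vec Bool r)
allVecs zero = [] ∷ []
allVecs (suc r) = map (false ∷_) (allVecs r) ++ map (true ∷_) (allVecs r)

b2n : Bool → ℕ
b2n false = 0
b2n true = 1

weight : ∀ {r} → Vec Bool r → ℕ
weight [] = 0
weight (x ∷ v) = b2n x + weight v

-- entry of M = A Aᵀ at (row u, column v): the integer dot product u · v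
Mentry : ∀ {r} → Vec Bool r → Vec Bool r → ℕ
Mentry [] [] = 0
Mentry (x ∷ u) (y ∷ v) = b2n x * b2n y + Mentry u v

digit : ℕ → ℕ → ℕ
digit zero x = x % 2
digit (suc i) x = digit i (x / 2)

-- the column indices of 𝔪_k : vectors ℓ with exactly k ones
colsOfWeight : (r k : ℕ) → List (Vec Bool r)
colsOfWeight r k = filterᵇ (λ w → weight w N.≡ᵇ k) (allVecs r)

-- Entry at row u of the Z/2-linear combination, with coefficients c, of the
-- columns of 𝔪_k^{[i]}; value is the representative in {0,1}.
combEntry : ∀ {r} → ℕ → ℕ → (Vec Bool r → Bool) → Vec Bool r → ℕ
combEntry {r} i k c u =
  sum (map (λ w → if c w then digit i (Mentry u w) else 0) (colsOfWeight r k)) % 2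

-- Identify the columns of M with subsets of {1..r}, so that M(u, w) = |u ∩ w|.
-- By Lucas's theorem the i-th binary digit of t is the parity of (t choose 2^i).
-- For w of weight 2^i this gives M(u, w)^[i] = [w ⊆ u], since |u ∩ w| ≤ 2^i with
-- equality iff w ⊆ u. For an arbitrary column v,
--   M(u, v)^[i] ≡ (|u ∩ v| choose 2^i) ≡ #{w ⊆ u ∩ v : |w| = 2^i}
--            = Σ_{|w| = 2^i, w ⊆ v} [w ⊆ u] = Σ_{|w| = 2^i, w ⊆ v} M(u, w)^[i]  (mod 2),
-- so the coefficients c(w) = [w ⊆ v] work.
module Submission where

open import Defs
open import Data.Bool using (Bool; true; false; if_then_else_; _∧_; _xor_; not; T)
open import Data.Bool.Properties using (∧-zeroʳ; ∧-identityʳ; xor-assoc; xor-same; xor-identityʳ; not-involutive)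
open import Data.Nat using (ℕ; zero; suc; _+_; _*_; _^_; _≥_; _≤_; _<_; z≤n; s≤s; _/_; _%_; _≡ᵇ_)
open import Data.Nat.Properties using (+-identityʳ; +-suc; +-comm; ≤-trans; n≤1+n; ≡ᵇ⇒≡)
open import Data.Nat.DivMod using (m/n≡1+[m∸n]/n; [m+n]%n≡m%n; %-distribˡ-+)
open import Data.Vec using (Vec; []; _∷_; zipWith)
open import Data.List using (List; []; _∷_; map; _++_; filterᵇ)
open import Data.List.Properties using (map-++; map-∘)
open import Data.Nat.ListAction using (sum)
open import Data.Nat.ListAction.Properties using (sum-++)
open import Data.Product using (∃; _,_)
open import Data.Unit using (tt)
open import Function using (_∘_)
open import Relation.Binary.PropositionalEquality
open ≡-Reasoning

oddBinomial : ℕ → ℕ → Bool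
oddBinomial n       zero    = true
oddBinomial zero    (suc k) = false
oddBinomial (suc n) (suc k) = oddBinomial n k xor oddBinomial n (suc k)

oddBinomial-< : ∀ {n k} → n < k → oddBinomial n k ≡ false
oddBinomial-< {zero}  {suc k} _ = refl
oddBinomial-< {suc n} {suc k} (s≤s n<k) =
  cong₂ _xor_ (oddBinomial-< n<k) (oddBinomial-< (s≤s (≤-trans (n≤1+n n) n<k)))

2+n%2 : ∀ n → suc (suc n) % 2 ≡ n % 2
2+n%2 n = trans (cong (_% 2) (+-comm 2 n)) ([m+n]%n≡m%n n 2)

oddBinomial-one : ∀ t → b2n (oddBinomial t 1) ≡ t % 2
oddBinomial-one zero          = refl
oddBinomial-one (suc zero)    = refl
oddBinomial-one (suc (suc t)) = begin
  b2n (not (not (oddBinomial t 1))) ≡⟨ cong b2n (not-involutive _) ⟩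
  b2n (oddBinomial t 1)             ≡⟨ oddBinomial-one t ⟩
  t % 2                             ≡⟨ 2+n%2 t ⟨
  suc (suc t) % 2                   ∎

double : ℕ → ℕ
double zero    = zero
double (suc n) = suc (suc (double n))

double≡2* : ∀ n → double n ≡ 2 * n
double≡2* zero    = refl
double≡2* (suc n) = trans (cong (λ m → suc (suc m)) (double≡2* n)) (cong suc (sym (+-suc n (n + 0))))

data EvenOdd : ℕ → Set where
  even : ∀ m → EvenOdd (double m)
  odd  : ∀ m → EvenOdd (suc (double m))

evenOdd : ∀ n → EvenOdd n
evenOdd zero = even zero
evenOdd (suc n) with evenOdd n
... | even m = odd m
... | odd m  = even (suc m)

2+n/2 : ∀ n → suc (suc n) / 2 ≡ suc (n / 2)
2+n/2 n = m/n≡1+[m∸n]/n {suc (suc n)} {2} (s≤s (s≤s z≤n))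

double/2 : ∀ m → double m / 2 ≡ m
double/2 zero    = refl
double/2 (suc m) = trans (2+n/2 (double m)) (cong suc (double/2 m))

1+double/2 : ∀ m → suc (double m) / 2 ≡ m
1+double/2 zero    = refl
1+double/2 (suc m) = trans (2+n/2 (suc (double m))) (cong suc (1+double/2 m))

xor-cancel-middle : ∀ a b c → (a xor b) xor (b xor c) ≡ a xor c
xor-cancel-middle a b c = begin
  (a xor b) xor (b xor c) ≡⟨ xor-assoc a b (b xor c) ⟩
  a xor (b xor (b xor c)) ≡⟨ cong (a xor_) (xor-assoc b b c) ⟨
  a xor ((b xor b) xor c) ≡⟨ cong (λ x → a xor (x xor c)) (xor-same b) ⟩
  a xor c                 ∎

mutual
  oddBinomial-double-double : ∀ m k → oddBinomial (double m) (double k) ≡ oddBinomial m k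
  oddBinomial-double-double zero    zero    = refl
  oddBinomial-double-double zero    (suc k) = refl
  oddBinomial-double-double (suc m) zero    = refl
  oddBinomial-double-double (suc m) (suc k) = begin
    (oddBinomial (double m) (double k) xor oddBinomial (double m) (suc (double k)))
      xor (oddBinomial (double m) (suc (double k)) xor oddBinomial (double m) (double (suc k)))
      ≡⟨ xor-cancel-middle (oddBinomial (double m) (double k)) _ _ ⟩
    oddBinomial (double m) (double k) xor oddBinomial (double m) (double (suc k))
      ≡⟨ cong₂ _xor_ (oddBinomial-double-double m k) (oddBinomial-double-double m (suc k)) ⟩
    oddBinomial m k xor oddBinomial m (suc k) ∎

  oddBinomial-double-odd : ∀ m k → oddBinomial (double m) (suc (double k)) ≡ false
  oddBinomial-double-odd zero    k       = refl
  oddBinomial-double-odd (suc m) zero    =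
    cong (λ x → not (not x)) (oddBinomial-double-odd m zero)
  oddBinomial-double-odd (suc m) (suc k) = begin
    (oddBinomial (double m) (suc (double k)) xor oddBinomial (double m) (double (suc k)))
      xor (oddBinomial (double m) (double (suc k)) xor oddBinomial (double m) (suc (double (suc k))))
      ≡⟨ xor-cancel-middle (oddBinomial (double m) (suc (double k))) _ _ ⟩
    oddBinomial (double m) (suc (double k)) xor oddBinomial (double m) (suc (double (suc k)))
      ≡⟨ cong₂ _xor_ (oddBinomial-double-odd m k) (oddBinomial-double-odd m (suc k)) ⟩
    false ∎

oddBinomial-odd-double : ∀ m k → oddBinomial (suc (double m)) (double k) ≡ oddBinomial m k
oddBinomial-odd-double m zero    = refl
oddBinomial-odd-double m (suc k) =
  cong₂ _xor_ (oddBinomial-double-odd m k) (oddBinomial-double-double m (suc k))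

oddBinomial-halve : ∀ t k → oddBinomial t (double k) ≡ oddBinomial (t / 2) k
oddBinomial-halve t k with evenOdd t
... | even m = trans (oddBinomial-double-double m k) (cong (λ h → oddBinomial h k) (sym (double/2 m)))
... | odd m  = trans (oddBinomial-odd-double m k) (cong (λ h → oddBinomial h k) (sym (1+double/2 m)))

digit≡oddBinomial : ∀ i t → digit i t ≡ b2n (oddBinomial t (2 ^ i))
digit≡oddBinomial zero    t = sym (oddBinomial-one t)
digit≡oddBinomial (suc i) t = begin
  digit i (t / 2)                          ≡⟨ digit≡oddBinomial i (t / 2) ⟩
  b2n (oddBinomial (t / 2) (2 ^ i))        ≡⟨ cong b2n (oddBinomial-halve t (2 ^ i)) ⟨
  b2n (oddBinomial t (double (2 ^ i)))     ≡⟨ cong (b2n ∘ oddBinomial t) (double≡2* (2 ^ i)) ⟩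
  b2n (oddBinomial t (2 ^ suc i))          ∎

_⊆ᵇ_ : ∀ {r} → Vec Bool r → Vec Bool r → Bool
[]          ⊆ᵇ []      = true
(false ∷ w) ⊆ᵇ (_ ∷ x) = w ⊆ᵇ x
(true ∷ w)  ⊆ᵇ (b ∷ x) = b ∧ (w ⊆ᵇ x)

_∩_ : ∀ {r} → Vec Bool r → Vec Bool r → Vec Bool r
_∩_ = zipWith _∧_

⊆ᵇ-∩ : ∀ {r} (w u v : Vec Bool r) → w ⊆ᵇ (u ∩ v) ≡ (w ⊆ᵇ u) ∧ (w ⊆ᵇ v)
⊆ᵇ-∩ []          []          []          = refl
⊆ᵇ-∩ (false ∷ w) (a ∷ u)     (b ∷ v)     = ⊆ᵇ-∩ w u v
⊆ᵇ-∩ (true ∷ w)  (false ∷ u) (b ∷ v)     = refl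
⊆ᵇ-∩ (true ∷ w)  (true ∷ u)  (false ∷ v) = sym (∧-zeroʳ (w ⊆ᵇ u))
⊆ᵇ-∩ (true ∷ w)  (true ∷ u)  (true ∷ v)  = ⊆ᵇ-∩ w u v

b2n-∧ : ∀ a b → b2n a * b2n b ≡ b2n (a ∧ b)
b2n-∧ false b     = refl
b2n-∧ true  false = refl
b2n-∧ true  true  = refl

Mentry≡weight-∩ : ∀ {r} (u v : Vec Bool r) → Mentry u v ≡ weight (u ∩ v)
Mentry≡weight-∩ []      []      = refl
Mentry≡weight-∩ (a ∷ u) (b ∷ v) = cong₂ _+_ (b2n-∧ a b) (Mentry≡weight-∩ u v)

Mentry≤weightʳ : ∀ {r} (u w : Vec Bool r) → Mentry u w ≤ weight w
Mentry≤weightʳ []          []          = z≤n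
Mentry≤weightʳ (true ∷ u)  (true ∷ w)  = s≤s (Mentry≤weightʳ u w)
Mentry≤weightʳ (false ∷ u) (true ∷ w)  = ≤-trans (Mentry≤weightʳ u w) (n≤1+n _)
Mentry≤weightʳ (true ∷ u)  (false ∷ w) = Mentry≤weightʳ u w
Mentry≤weightʳ (false ∷ u) (false ∷ w) = Mentry≤weightʳ u w

oddBinomial-Mentry-weight : ∀ {r} (u w : Vec Bool r) →
  oddBinomial (Mentry u w) (weight w) ≡ w ⊆ᵇ u
oddBinomial-Mentry-weight []          []          = refl
oddBinomial-Mentry-weight (true ∷ u)  (true ∷ w)  = begin
  oddBinomial (Mentry u w) (weight w) xor oddBinomial (Mentry u w) (suc (weight w))
    ≡⟨ cong₂ _xor_ (oddBinomial-Mentry-weight u w) (oddBinomial-< (s≤s (Mentry≤weightʳ u w))) ⟩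
  (w ⊆ᵇ u) xor false
    ≡⟨ xor-identityʳ (w ⊆ᵇ u) ⟩
  w ⊆ᵇ u ∎
oddBinomial-Mentry-weight (false ∷ u) (true ∷ w)  = oddBinomial-< (s≤s (Mentry≤weightʳ u w))
oddBinomial-Mentry-weight (true ∷ u)  (false ∷ w) = oddBinomial-Mentry-weight u w
oddBinomial-Mentry-weight (false ∷ u) (false ∷ w) = oddBinomial-Mentry-weight u w

digit-Mentry-weight-2^ : ∀ {r} i (u w : Vec Bool r) → weight w ≡ 2 ^ i →
  digit i (Mentry u w) ≡ b2n (w ⊆ᵇ u)
digit-Mentry-weight-2^ i u w |w|≡2^i = begin
  digit i (Mentry u w)                   ≡⟨ digit≡oddBinomial i (Mentry u w) ⟩
  b2n (oddBinomial (Mentry u w) (2 ^ i)) ≡⟨ cong (b2n ∘ oddBinomial (Mentry u w)) |w|≡2^i ⟨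
  b2n (oddBinomial (Mentry u w) (weight w)) ≡⟨ cong b2n (oddBinomial-Mentry-weight u w) ⟩
  b2n (w ⊆ᵇ u)                           ∎

if-b2n : ∀ a b → (if b then b2n a else 0) ≡ b2n (a ∧ b)
if-b2n a false = cong b2n (sym (∧-zeroʳ a))
if-b2n a true  = cong b2n (sym (∧-identityʳ a))

digit-column-⊆ᵇ : ∀ {r} i (u v w : Vec Bool r) → weight w ≡ 2 ^ i →
  (if w ⊆ᵇ v then digit i (Mentry u w) else 0) ≡ b2n (w ⊆ᵇ (u ∩ v))
digit-column-⊆ᵇ i u v w |w|≡2^i = begin
  (if w ⊆ᵇ v then digit i (Mentry u w) else 0)
    ≡⟨ cong (λ d → if w ⊆ᵇ v then d else 0) (digit-Mentry-weight-2^ i u w |w|≡2^i) ⟩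
  (if w ⊆ᵇ v then b2n (w ⊆ᵇ u) else 0)
    ≡⟨ if-b2n (w ⊆ᵇ u) (w ⊆ᵇ v) ⟩
  b2n ((w ⊆ᵇ u) ∧ (w ⊆ᵇ v))
    ≡⟨ cong b2n (⊆ᵇ-∩ w u v) ⟨
  b2n (w ⊆ᵇ (u ∩ v)) ∎

∑ : ∀ r → (Vec Bool r → ℕ) → ℕ
∑ zero    f = f []
∑ (suc r) f = ∑ r (λ w → f (false ∷ w)) + ∑ r (λ w → f (true ∷ w))

∑-cong : ∀ r {f g : Vec Bool r → ℕ} → (∀ w → f w ≡ g w) → ∑ r f ≡ ∑ r g
∑-cong zero    f≗g = f≗g []
∑-cong (suc r) f≗g = cong₂ _+_ (∑-cong r (λ w → f≗g (false ∷ w))) (∑-cong r (λ w → f≗g (true ∷ w)))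

∑-zero : ∀ r {f : Vec Bool r → ℕ} → (∀ w → f w ≡ 0) → ∑ r f ≡ 0
∑-zero zero    f≗0 = f≗0 []
∑-zero (suc r) f≗0 = cong₂ _+_ (∑-zero r (λ w → f≗0 (false ∷ w))) (∑-zero r (λ w → f≗0 (true ∷ w)))

sum-allVecs : ∀ r (f : Vec Bool r → ℕ) → sum (map f (allVecs r)) ≡ ∑ r f
sum-allVecs zero    f = +-identityʳ (f [])
sum-allVecs (suc r) f = begin
  sum (map f (map (false ∷_) (allVecs r) ++ map (true ∷_) (allVecs r)))
    ≡⟨ cong sum (map-++ f (map (false ∷_) (allVecs r)) _) ⟩
  sum (map f (map (false ∷_) (allVecs r)) ++ map f (map (true ∷_) (allVecs r)))
    ≡⟨ sum-++ (map f (map (false ∷_) (allVecs r))) _ ⟩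
  sum (map f (map (false ∷_) (allVecs r))) + sum (map f (map (true ∷_) (allVecs r)))
    ≡⟨ cong₂ _+_ (cong sum (map-∘ (allVecs r))) (cong sum (map-∘ (allVecs r))) ⟨
  sum (map (λ w → f (false ∷ w)) (allVecs r)) + sum (map (λ w → f (true ∷ w)) (allVecs r))
    ≡⟨ cong₂ _+_ (sum-allVecs r _) (sum-allVecs r _) ⟩
  ∑ (suc r) f ∎

sum-filterᵇ : ∀ {A : Set} (p : A → Bool) (g : A → ℕ) (xs : List A) →
  sum (map g (filterᵇ p xs)) ≡ sum (map (λ x → if p x then g x else 0) xs)
sum-filterᵇ p g []       = refl
sum-filterᵇ p g (x ∷ xs) with p x
... | true  = cong (g x +_) (sum-filterᵇ p g xs)
... | false = sum-filterᵇ p g xs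

+-%2-xor : ∀ m n {a b} → m % 2 ≡ b2n a → n % 2 ≡ b2n b → (m + n) % 2 ≡ b2n (b xor a)
+-%2-xor m n {a} {b} m≡a n≡b = begin
  (m + n) % 2             ≡⟨ %-distribˡ-+ m n 2 ⟩
  (m % 2 + n % 2) % 2     ≡⟨ cong₂ (λ x y → (x + y) % 2) m≡a n≡b ⟩
  (b2n a + b2n b) % 2     ≡⟨ b2n-xor a b ⟩
  b2n (b xor a)           ∎
  where
  b2n-xor : ∀ a b → (b2n a + b2n b) % 2 ≡ b2n (b xor a)
  b2n-xor false false = refl
  b2n-xor false true  = refl
  b2n-xor true  false = refl
  b2n-xor true  true  = refl

subsetsOfWeight : ∀ r → ℕ → Vec Bool r → ℕ
subsetsOfWeight r k x = ∑ r (λ w → b2n ((weight w ≡ᵇ k) ∧ (w ⊆ᵇ x)))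

+-zeroʳ-%2 : ∀ m {n} → n ≡ 0 → (m + n) % 2 ≡ m % 2
+-zeroʳ-%2 m refl = cong (_% 2) (+-identityʳ m)

subsetsOfWeight-parity : ∀ r k (x : Vec Bool r) →
  subsetsOfWeight r k x % 2 ≡ b2n (oddBinomial (weight x) k)
subsetsOfWeight-parity zero    zero    []          = refl
subsetsOfWeight-parity zero    (suc k) []          = refl
subsetsOfWeight-parity (suc r) k       (false ∷ x) =
  trans (+-zeroʳ-%2 (subsetsOfWeight r k x) (∑-zero r (λ w → cong b2n (∧-zeroʳ _))))
        (subsetsOfWeight-parity r k x)
subsetsOfWeight-parity (suc r) zero    (true ∷ x)  =
  trans (+-zeroʳ-%2 (subsetsOfWeight r zero x) (∑-zero r (λ _ → refl)))
        (subsetsOfWeight-parity r zero x)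
subsetsOfWeight-parity (suc r) (suc k) (true ∷ x)  =
  +-%2-xor (subsetsOfWeight r (suc k) x) (subsetsOfWeight r k x)
    (subsetsOfWeight-parity r (suc k) x) (subsetsOfWeight-parity r k x)

lemma13 : (r i z : ℕ) → r ≥ 1 → i ≥ 1 → z ≥ 1 →
    (v : Vec Bool r) → weight v ≡ 2 ^ i + z →
    ∃ λ (c : Vec Bool r → Bool) →
    (u : Vec Bool r) → digit i (Mentry u v) ≡ combEntry i (2 ^ i) c u
lemma13 r i z _ _ _ v _ = (λ w → w ⊆ᵇ v) , λ u → begin
    digit i (Mentry u v)                                             ≡⟨ digit≡oddBinomial i (Mentry u v) ⟩
    b2n (oddBinomial (Mentry u v) (2 ^ i))                           ≡⟨ cong (λ t → b2n (oddBinomial t (2 ^ i))) (Mentry≡weight-∩ u v) ⟩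
    b2n (oddBinomial (weight (u ∩ v)) (2 ^ i))                       ≡⟨ subsetsOfWeight-parity r (2 ^ i) (u ∩ v) ⟨
    subsetsOfWeight r (2 ^ i) (u ∩ v) % 2                           ≡⟨ cong (_% 2) (∑-cong r (term u)) ⟨
    ∑ r (λ w → if weight w ≡ᵇ 2 ^ i then column u w else 0) % 2     ≡⟨ cong (_% 2) (sum-allVecs r _) ⟨
    sum (map (λ w → if weight w ≡ᵇ 2 ^ i then column u w else 0) (allVecs r)) % 2
      ≡⟨ cong (_% 2) (sum-filterᵇ (λ w → weight w ≡ᵇ 2 ^ i) (column u) (allVecs r)) ⟨
    combEntry i (2 ^ i) (λ w → w ⊆ᵇ v) u                             ∎
  where
  column : Vec Bool r → Vec Bool r → ℕ
  column u w = if w ⊆ᵇ v then digit i (Mentry u w) else 0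

  term : ∀ u w → (if weight w ≡ᵇ 2 ^ i then column u w else 0) ≡ b2n ((weight w ≡ᵇ 2 ^ i) ∧ (w ⊆ᵇ (u ∩ v)))
  term u w with weight w ≡ᵇ 2 ^ i in eq
  ... | false = refl
  ... | true = digit-column-⊆ᵇ i u v w (≡ᵇ⇒≡ (weight w) (2 ^ i) (subst T (sym eq) tt))
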